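{- Let $H=(\mathcal{V},\mathcal{E})$ be a hypergraph with $m$ hyperedges, $k$ a positive integer, and $G_k$ the conflict graph of $H$. Suppose $\alpha(G_k)=m$. Let $\mathcal{A}$ be any maximum independent set of $G_k$, and let $f:\mathcal{V}\to\{0,1,\dots,k\}$ be given by $f(v)=c$ if there is $e$ with $(e,v,c)\in\mathcal{A}$, and $f(v)=0$ otherwise. Then $f$ is a well-defined function and is a conflict-free colouring of $H$ with at most $k$ non-zero colours.
   Context: A hypergraph has finite vertex set $\mathcal{V}$ and family $\mathcal{E}$ of nonempty hyperedges. A function $C:\mathcal{V}\to\{0,1,\dots,k\}$ is a conflict-free colouring of $H$ if for every $e\in\mathcal{E}$ there is a non-zero colour $j$ with $|e\cap C^{ -1}(j)|=1$. The conflict graph $G_k$ has nodes $(e,v,c)$ with $e\in\mathcal{E}$, $v\in e$, $1\le c\le k$, and edge set $E_{vertex}\cup E_{edge}\cup E_{colour}$: $E_{vertex}$ = pairs $(e,v,c),(g,v,d)$ with $c\ne d$; $E_{edge}$ = pairs of distinct nodes $(e,v,c),(e,u,d)$ with the same hyperedge coordinate; $E_{colour}$ = pairs $(e,v,c),(g,u,c)$ with $u\ne v$ and $\{u,v\}\subseteq e$ or $\{u,v\}\subseteq g$. $\alpha(G)$ denotes the independence number. -}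

module Defs where

open import Data.Nat using (ℕ)
open import Data.Fin using (Fin; zero; suc)
open import Data.Fin.Subset using (Subset; _∈_; Nonempty)
open import Data.Product using (Σ; ∃; _×_; _,_)
open import Data.Sum using (_⊎_)
open import Data.List using (List; length)
open import Data.List.Membership.Propositional renaming (_∈_ to _∈ₗ_)
open import Data.List.Relation.Unary.All using (All)
open import Data.List.Relation.Unary.Unique.Propositional using (Unique)
open import Relation.Binary.PropositionalEquality using (_≡_; _≢_)
open import Relation.Nullary using (¬_)
open import Function.Definitions using (Injective)

record Hypergraph (n m : ℕ) : Set where
  field
    edge     : Fin m → Subset n
    nonempty : ∀ e → Nonempty (edge e)
    distinct : Injective _≡_ _≡_ edge

open Hypergraph public

-- Candidate nodes (e , v , c) of G_k; the colour c ∈ {1..k} is encoded by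
-- c : Fin k, standing for colour (suc c) in Fin (suc k) (0 = uncoloured).
Triple : ℕ → ℕ → ℕ → Set
Triple n m k = Fin m × Fin n × Fin k

IsNode : ∀ {n m k} → Hypergraph n m → Triple n m k → Set
IsNode H (e , v , c) = v ∈ edge H e

-- Adjacency in G_k : E_vertex ∪ E_edge ∪ E_colour
Adjacent : ∀ {n m k} → Hypergraph n m → Triple n m k → Triple n m k → Set
Adjacent H (e , v , c) (g , u , d) =
  (v ≡ u × c ≢ d)
  ⊎ ((e ≡ g × (e , v , c) ≢ (g , u , d))
  ⊎ (c ≡ d × u ≢ v × ((u ∈ edge H e × v ∈ edge H e) ⊎ (u ∈ edge H g × v ∈ edge H g))))

record Independent {n m k} (H : Hypergraph n m) (A : List (Triple n m k)) : Set where
  field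
    nodes  : All (IsNode H) A
    unique : Unique A
    indep  : ∀ {x y} → x ∈ₗ A → y ∈ₗ A → ¬ Adjacent H x y

open import Data.Nat using (_≤_)
IndependenceNumber : ∀ {n m} → Hypergraph n m → (k a : ℕ) → Set
IndependenceNumber {n} {m} H k a =
  (Σ (List (Triple n m k)) λ A → Independent H A × length A ≡ a)
  × (∀ (B : List (Triple n m k)) → Independent H B → length B ≤ a)

MaximumIndependent : ∀ {n m k} → Hypergraph n m → List (Triple n m k) → Set
MaximumIndependent {n} {m} {k} H A =
  Independent H A × (∀ (B : List (Triple n m k)) → Independent H B → length B ≤ length A)

ConflictFree : ∀ {n m k} → Hypergraph n m → (Fin n → Fin (ℕ.suc k)) → Set
ConflictFree {n} {m} {k} H C =
  ∀ (e : Fin m) → ∃ λ (j : Fin k) → ∃ λ (v : Fin n) →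
    v ∈ edge H e × C v ≡ suc j
    × (∀ u → u ∈ edge H e → C u ≡ suc j → u ≡ v)

module Submission where

-- Let A be a maximum independent set of the conflict graph G_k,
-- so |A| = α(G_k) = m.
--  * Two nodes of A never share a hyperedge coordinate (E_edge), so the
--    hyperedge coordinates of A form a duplicate-free list of m elements of
--    Fin m; by a counting argument every hyperedge e occurs, say as (e,v,c).
--  * Two nodes of A never give one vertex two colours (E_vertex), so
--    f v = "the colour of v in A, or 0" is well defined; we compute it as
--    the colour of the first node of A on v.
--  * If u ∈ e also has colour c in A, via some (g,u,c), then u = v, for
--    otherwise (e,v,c) and (g,u,c) would be adjacent (E_colour, as u,v ∈ e).
--    Hence v is the unique vertex of e of colour c: f is conflict-free.

open import Defs
open import Data.Nat using (ℕ; NonZero)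
open import Data.Fin using (Fin; zero; suc)
open import Data.Product using (Σ; ∃; _×_; _,_)
open import Data.List using (List)
open import Data.List.Membership.Propositional using (_∈_)
open import Relation.Binary.PropositionalEquality using (_≡_)
open import Relation.Nullary using (¬_)

open import Data.Nat using (_≤_; s≤s)
open import Data.Nat.Properties using (≤-antisym; ≤-trans; ≤-reflexive; 1+n≰n)
open import Data.Fin.Properties using (_≟_; injective⇒≤)
open import Data.Fin.Subset using () renaming (_∈_ to _∈ₛ_)
open import Data.Product using (proj₁)
open import Data.Sum using (inj₁; inj₂)
open import Data.List using ([]; _∷_; length; lookup; map)
open import Data.List.Properties using (length-map)
open import Data.List.Relation.Unary.All as All using ()
open import Data.List.Relation.Unary.All.Properties using (¬Any⇒All¬; map⁺)
open import Data.List.Relation.Unary.Any using (here; there)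
open import Data.List.Relation.Unary.AllPairs using ([]; _∷_)
open import Data.List.Relation.Unary.Unique.Propositional using (Unique)
open import Data.List.Membership.Propositional.Properties using (∈-lookup; ∈-map⁻)
import Data.List.Membership.DecPropositional as DecMembership
open import Relation.Binary.PropositionalEquality using (refl; sym; trans; cong; _≢_)
open import Relation.Nullary using (yes; no)
open import Data.Empty using (⊥-elim)

lookup-injective : ∀ {a} {A : Set a} {xs : List A} → Unique xs →
  ∀ i j → lookup xs i ≡ lookup xs j → i ≡ j
lookup-injective (_ ∷ _)    zero    zero    _  = refl
lookup-injective (x∉xs ∷ u) zero    (suc j) eq = ⊥-elim (All.lookup x∉xs (∈-lookup j) eq)
lookup-injective (x∉xs ∷ u) (suc i) zero    eq = ⊥-elim (All.lookup x∉xs (∈-lookup i) (sym eq))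
lookup-injective (x∉xs ∷ u) (suc i) (suc j) eq = cong suc (lookup-injective u i j eq)

unique-length≤ : ∀ {m} {xs : List (Fin m)} → Unique xs → length xs ≤ m
unique-length≤ u = injective⇒≤ (lookup-injective u _ _)

-- A duplicate-free list of exactly m elements of Fin m contains all of them:
-- a missing x could be prepended to obtain m + 1 distinct elements.
unique-full⇒complete : ∀ {m} {xs : List (Fin m)} → Unique xs → length xs ≡ m →
  ∀ x → x ∈ xs
unique-full⇒complete {xs = xs} u len x with DecMembership._∈?_ _≟_ x xs
... | yes x∈xs = x∈xs
... | no  x∉xs = ⊥-elim (1+n≰n (≤-trans (s≤s (≤-reflexive (sym len)))
                                        (unique-length≤ (¬Any⇒All¬ xs x∉xs ∷ u))))

unique-map : ∀ {a b} {A : Set a} {B : Set b} {f : A → B} {xs : List A} → Unique xs →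
  (∀ {x y} → x ∈ xs → y ∈ xs → x ≢ y → f x ≢ f y) → Unique (map f xs)
unique-map [] separates = []
unique-map (x∉xs ∷ u) separates =
  map⁺ (All.tabulate λ y∈xs → separates (here refl) (there y∈xs) (All.lookup x∉xs y∈xs))
  ∷ unique-map u (λ p q → separates (there p) (there q))

module _ {n m k : ℕ} where

  colourOf : List (Triple n m k) → Fin n → Fin (ℕ.suc k)
  colourOf []                  v = zero
  colourOf ((e , u , c) ∷ A) v with v ≟ u
  ... | yes _ = suc c
  ... | no  _ = colourOf A v

  colourOf-sound : ∀ A {v c} → colourOf A v ≡ suc c → ∃ λ e → (e , v , c) ∈ A
  colourOf-sound [] ()
  colourOf-sound ((e , u , c) ∷ A) {v} eq with v ≟ u
  colourOf-sound ((e , u , c) ∷ A) refl | yes refl = e , here refl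
  colourOf-sound ((e , u , c) ∷ A) eq   | no  _ with colourOf-sound A eq
  ... | e′ , p = e′ , there p

  colourOf-coloured : ∀ A {e v c} → (e , v , c) ∈ A → ∃ λ d → colourOf A v ≡ suc d
  colourOf-coloured ((e′ , u , d) ∷ A) {v = v} p with v ≟ u
  colourOf-coloured ((e′ , u , d) ∷ A) _           | yes _   = d , refl
  colourOf-coloured ((e′ , u , d) ∷ A) (here refl) | no v≢u = ⊥-elim (v≢u refl)
  colourOf-coloured ((e′ , u , d) ∷ A) (there p)   | no _   = colourOf-coloured A p

  colourOf-uncoloured : ∀ A {v} → ¬ (∃ λ e → ∃ λ c → (e , v , c) ∈ A) → colourOf A v ≡ zero
  colourOf-uncoloured [] _ = refl
  colourOf-uncoloured ((e , u , c) ∷ A) {v} absent with v ≟ u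
  ... | yes refl = ⊥-elim (absent (e , c , here refl))
  ... | no  _    = colourOf-uncoloured A λ (e′ , c′ , p) → absent (e′ , c′ , there p)

  Functional : List (Triple n m k) → Set
  Functional A = ∀ {e g v c d} → (e , v , c) ∈ A → (g , v , d) ∈ A → c ≡ d

  colourOf-member : ∀ {A e v c} → Functional A → (e , v , c) ∈ A → colourOf A v ≡ suc c
  colourOf-member {A} functional p with colourOf-coloured A p
  ... | d , eq with colourOf-sound A eq
  ...   | _ , q = trans eq (cong suc (functional q p))

module _ {n m k : ℕ} (H : Hypergraph n m) where

  independent⇒functional : ∀ {A : List (Triple n m k)} → Independent H A → Functional A
  independent⇒functional I {c = c} {d} p q with c ≟ d
  ... | yes c≡d = c≡d
  ... | no  c≢d = ⊥-elim (Independent.indep I p q (inj₁ (refl , c≢d)))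

  maximum-size : ∀ {a} {A : List (Triple n m k)} → IndependenceNumber H k a →
    MaximumIndependent H A → length A ≡ a
  maximum-size {A = A} ((B , indepB , lenB) , α-bound) (indepA , maximal) =
    ≤-antisym (α-bound A indepA) (≤-trans (≤-reflexive (sym lenB)) (maximal B indepB))

  independent-covers : ∀ {A : List (Triple n m k)} → Independent H A → length A ≡ m →
    ∀ e → ∃ λ t → t ∈ A × e ≡ proj₁ t
  independent-covers {A} I len e =
    ∈-map⁻ proj₁ (unique-full⇒complete edges-unique (trans (length-map proj₁ A) len) e)
    where
    open Independent I
    edges-unique : Unique (map proj₁ A)
    edges-unique = unique-map unique λ p q x≢y e≡g → indep p q (inj₂ (inj₁ (e≡g , x≢y)))

  -- E_colour: if an independent set meets every hyperedge coordinate, its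
  -- colouring is conflict-free; the covering node (e,v,c) makes v the unique
  -- vertex of e of colour c.
  covering⇒conflictFree : ∀ {A : List (Triple n m k)} → Independent H A →
    (∀ e → ∃ λ t → t ∈ A × e ≡ proj₁ t) → ConflictFree H (colourOf A)
  covering⇒conflictFree {A} I covers e with covers e
  ... | (.e , v , c) , p , refl = c , v , v∈e , colourOf-member functional p , only-v
    where
    open Independent I
    functional = independent⇒functional I
    v∈e = All.lookup nodes p
    only-v : ∀ u → u ∈ₛ edge H e → colourOf A u ≡ suc c → u ≡ v
    only-v u u∈e eq with u ≟ v
    ... | yes u≡v = u≡v
    ... | no  u≢v with colourOf-sound A eq
    ...   | g , q = ⊥-elim (indep p q (inj₂ (inj₂ (refl , u≢v , inj₁ (u∈e , v∈e)))))

lemma1 : ∀ {n m} (H : Hypergraph n m) (k : ℕ) → NonZero k →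
    IndependenceNumber H k m →
    (A : List (Triple n m k)) → MaximumIndependent H A →
    -- f is well defined
    (∀ {e g v c d} → (e , v , c) ∈ A → (g , v , d) ∈ A → c ≡ d)
    × (Σ (Fin n → Fin (ℕ.suc k)) λ f →
        -- f is the function described: f v = c if some (e,v,c) ∈ A, else 0
        (∀ e v c → (e , v , c) ∈ A → f v ≡ suc c)
        × (∀ v → ¬ (∃ λ e → ∃ λ c → (e , v , c) ∈ A) → f v ≡ zero)
        -- and f is a conflict-free colouring with colours in {0,…,k}
        × ConflictFree H f)
lemma1 H k _ α≡m A maximum@(I , _) =
  functional
  , colourOf A
  , (λ _ _ _ → colourOf-member functional)
  , (λ _ → colourOf-uncoloured A)
  , covering⇒conflictFree H I (independent-covers H I (maximum-size H α≡m maximum))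
  where
  functional = independent⇒functional H I
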